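{- Suppose that there exists a constant $M$ such that $\chi_{\rho}(H)\le M$ holds for every subcubic graph $H$. If $G$ is a subcubic graph such that $\chi_{\rho}(G)=M$, then either $\chi_{\rho}(S_e(G))\le M-2$ for every edge $e\in E(G)$, or $\operatorname{diam}(G)\ge \lceil M/2\rceil -2$.
   Context: All graphs are finite and simple. A graph is subcubic if its maximum degree is at most $3$. For a graph $G$ with shortest-path distance $d_G$, a $k$-packing coloring is a map $c:V(G)\to\{1,\dots,k\}$ such that whenever $c(u)=c(v)=i$ for distinct $u,v$, we have $d_G(u,v)>i$. The packing chromatic number $\chi_{\rho}(G)$ is the smallest $k$ for which a $k$-packing coloring of $G$ exists. For an edge $e$ of $G$, $S_e(G)$ denotes the graph obtained from $G$ by subdividing $e$ (replacing $e=xy$ by a path $x,z,y$ through a new vertex $z$). $\operatorname{diam}(G)$ is the diameter of $G$. -}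

module Defs where

open import Data.Nat using (ℕ; zero; suc; _+_; _≤_; _<_; _∸_; _/_)
open import Data.Bool using (Bool; true; false; _∧_; _∨_; not)
open import Data.Fin using (Fin; zero; suc)
open import Data.Fin.Properties using (_≟_)
open import Data.List using (List; length; filterᵇ; allFin)
open import Data.Product using (Σ; ∃; _×_; _,_)
open import Data.Sum using (_⊎_)
open import Relation.Nullary using (¬_; does)
open import Relation.Binary.PropositionalEquality using (_≡_)

Adjacency : ℕ → Set
Adjacency n = Fin n → Fin n → Bool

IsSimple : {n : ℕ} → Adjacency n → Set
IsSimple {n} adj = ((u v : Fin n) → adj u v ≡ adj v u) × ((u : Fin n) → adj u u ≡ false)

degree : {n : ℕ} → Adjacency n → Fin n → ℕ
degree {n} adj v = length (filterᵇ (adj v) (allFin n))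

Subcubic : {n : ℕ} → Adjacency n → Set
Subcubic {n} adj = (v : Fin n) → degree adj v ≤ 3

data Walk {n : ℕ} (adj : Adjacency n) : Fin n → Fin n → ℕ → Set where
  here : {u : Fin n} → Walk adj u u 0
  step : {u w v : Fin n} {k : ℕ} → adj u w ≡ true → Walk adj w v k → Walk adj u v (suc k)

DistLe : {n : ℕ} → Adjacency n → Fin n → Fin n → ℕ → Set
DistLe adj u v i = Σ ℕ λ k → (k ≤ i) × Walk adj u v k

IsPackingColoring : {n : ℕ} → Adjacency n → ℕ → (Fin n → ℕ) → Set
IsPackingColoring {n} adj k c =
  ((v : Fin n) → (1 ≤ c v) × (c v ≤ k)) ×
  ((u v : Fin n) → ¬ (u ≡ v) → c u ≡ c v → ¬ DistLe adj u v (c u))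

PackChromLe : {n : ℕ} → Adjacency n → ℕ → Set
PackChromLe {n} adj k = Σ (Fin n → ℕ) λ c → IsPackingColoring adj k c

PackChromEq : {n : ℕ} → Adjacency n → ℕ → Set
PackChromEq adj k = PackChromLe adj k × ((j : ℕ) → j < k → ¬ PackChromLe adj j)

-- diam(G) ≥ D : some pair u,v has d_G(u,v) ≥ D, i.e. no walk of length < D
-- (a disconnected graph has infinite diameter).
DiamGe : {n : ℕ} → Adjacency n → ℕ → Set
DiamGe {n} adj D = Σ (Fin n) λ u → Σ (Fin n) λ v → (k : ℕ) → k < D → ¬ Walk adj u v k

eqᵇ : {n : ℕ} → Fin n → Fin n → Bool
eqᵇ a b = does (a ≟ b)

-- S_e(G) for e = xy: the new vertex is 'zero', old vertex a becomes 'suc a';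
-- the edge xy is removed and the new vertex is joined to x and y.
subdivide : {n : ℕ} → Adjacency n → Fin n → Fin n → Adjacency (suc n)
subdivide adj x y zero zero = false
subdivide adj x y zero (suc b) = eqᵇ b x ∨ eqᵇ b y
subdivide adj x y (suc a) zero = eqᵇ a x ∨ eqᵇ a y
subdivide adj x y (suc a) (suc b) =
  adj a b ∧ not ((eqᵇ a x ∧ eqᵇ b y) ∨ (eqᵇ a y ∧ eqᵇ b x))

ceilHalf : ℕ → ℕ
ceilHalf m = suc m / 2

module Submission where

-- Put L = M - 2 and D = ⌈M/2⌉ - 2.  Either some pair of
-- vertices of G is at distance ≥ D, which is the second alternative, or any two vertices
-- are joined by a walk shorter than D.  In the latter case fix an edge xy, let S = S_xy(G)
-- and let z be its new vertex; every vertex of S is within distance D of z.  Let H consist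
-- of two disjoint copies of S whose two copies of z are joined by an edge.  H is subcubic
-- (z has degree 2 in S) and any two of its vertices are at distance ≤ D + 1 + D ≤ L, so a
-- colouring of H by at most M = L + 2 colours, which exists by hypothesis, uses each colour
-- ≥ L at most once.  As there are only three such colours, one copy of S contains at most
-- one vertex of colour ≥ L, and recolouring that vertex with L yields an L-packing colouring
-- of S.

open import Defs
open import Data.Nat using (ℕ; zero; suc; _+_; _*_; _≤_; _<_; _∸_; _⊓_; z≤n; s≤s; _≤?_)
open import Data.Nat.Properties
open import Data.Nat.DivMod using (m/n*n≤m)
open import Data.Nat.Tactic.RingSolver using (solve-∀)
open import Data.Bool using (Bool; true; false; _∧_; _∨_)
open import Data.Bool.Properties using (∧-zeroʳ; ∧-comm; ∨-comm) renaming (_≟_ to _≟ᵇ_)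
open import Data.Fin using (Fin; zero; suc; toℕ; fromℕ<; _↑ˡ_; _↑ʳ_; splitAt)
open import Data.Fin.Patterns using (0F; 1F; 2F; 3F)
import Data.Fin.Properties as FinP
open import Data.List using (length; filterᵇ; tabulate)
open import Data.Product using (Σ; _×_; _,_; proj₁; proj₂)
open import Data.Sum using (_⊎_; inj₁; inj₂)
open import Data.Empty using (⊥; ⊥-elim)
open import Function using (_∘_)
open import Function.Definitions using (Injective)
open import Relation.Nullary using (¬_; Dec; yes; no; ¬?)
open import Relation.Nullary.Decidable using (dec-true; dec-false; map′; _×-dec_; decidable-stable)
open import Relation.Binary.PropositionalEquality

indicator : Bool → ℕ
indicator true = 1
indicator false = 0

indicator≤1 : ∀ t → indicator t ≤ 1
indicator≤1 true = ≤-refl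
indicator≤1 false = z≤n

indicator-mono : ∀ {a b} → (a ≡ true → b ≡ true) → indicator a ≤ indicator b
indicator-mono {false} _ = z≤n
indicator-mono {true} a⇒b rewrite a⇒b refl = ≤-refl

indicator-∨ : ∀ a b → indicator (a ∨ b) ≤ indicator a + indicator b
indicator-∨ true b = s≤s z≤n
indicator-∨ false b = ≤-refl

∧-true-left : ∀ a b → a ∧ b ≡ true → a ≡ true
∧-true-left true b _ = refl

eqᵇ-refl : ∀ {n} (a : Fin n) → eqᵇ a a ≡ true
eqᵇ-refl a = dec-true (a FinP.≟ a) refl

eqᵇ-≢ : ∀ {n} {a b : Fin n} → ¬ a ≡ b → eqᵇ a b ≡ false
eqᵇ-≢ {a = a} {b} a≢b = dec-false (a FinP.≟ b) a≢b

count : ∀ {n} → (Fin n → Bool) → ℕ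
count {zero} f = 0
count {suc n} f = indicator (f zero) + count (f ∘ suc)

degree≡count : ∀ {n} (adj : Adjacency n) v → degree adj v ≡ count (adj v)
degree≡count adj v = length-filter (adj v) (λ i → i)
  where
  length-filter : ∀ {A : Set} {n} (p : A → Bool) (f : Fin n → A) →
    length (filterᵇ p (tabulate f)) ≡ count (p ∘ f)
  length-filter {n = zero} p f = refl
  length-filter {n = suc n} p f with p (f zero)
  ... | true = cong suc (length-filter p (f ∘ suc))
  ... | false = length-filter p (f ∘ suc)

count-cong : ∀ {n} {f g : Fin n → Bool} → (∀ i → f i ≡ g i) → count f ≡ count g
count-cong {zero} f≡g = refl
count-cong {suc n} f≡g = cong₂ _+_ (cong indicator (f≡g zero)) (count-cong (f≡g ∘ suc))

count-mono : ∀ {n} {f g : Fin n → Bool} → (∀ i → f i ≡ true → g i ≡ true) → count f ≤ count g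
count-mono {zero} f⇒g = z≤n
count-mono {suc n} f⇒g = +-mono-≤ (indicator-mono (f⇒g zero)) (count-mono (f⇒g ∘ suc))

count-mono-< : ∀ {n} {f g : Fin n → Bool} (w : Fin n) → (∀ i → f i ≡ true → g i ≡ true) →
  f w ≡ false → g w ≡ true → count f < count g
count-mono-< zero f⇒g fw gw rewrite fw | gw = s≤s (count-mono (f⇒g ∘ suc))
count-mono-< (suc w) f⇒g fw gw =
  +-mono-≤-< (indicator-mono (f⇒g zero)) (count-mono-< w (f⇒g ∘ suc) fw gw)

count-false : ∀ {n} → count {n} (λ _ → false) ≡ 0
count-false {zero} = refl
count-false {suc n} = count-false {n}

count-∨ : ∀ {n} (f g : Fin n → Bool) → count (λ i → f i ∨ g i) ≤ count f + count g
count-∨ {zero} f g = z≤n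
count-∨ {suc n} f g = begin
    indicator (f zero ∨ g zero) + count (λ i → f (suc i) ∨ g (suc i))
  ≤⟨ +-mono-≤ (indicator-∨ (f zero) (g zero)) (count-∨ (f ∘ suc) (g ∘ suc)) ⟩
    (indicator (f zero) + indicator (g zero)) + (count (f ∘ suc) + count (g ∘ suc))
  ≡⟨ interchange (indicator (f zero)) (indicator (g zero)) (count (f ∘ suc)) (count (g ∘ suc)) ⟩
    (indicator (f zero) + count (f ∘ suc)) + (indicator (g zero) + count (g ∘ suc))
  ∎
  where
  open ≤-Reasoning
  interchange : ∀ a b c d → (a + b) + (c + d) ≡ (a + c) + (b + d)
  interchange = solve-∀

count-single : ∀ {n} (x : Fin n) → count (λ b → eqᵇ b x) ≡ 1
count-single {suc n} zero = cong suc (count-false {n})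
count-single {suc n} (suc x) = count-single x

-- The row of the bridge edge in the doubled graph: one neighbour exactly when t holds.
count-guarded-single : ∀ {n} t (r : Fin n) → count (λ b → t ∧ eqᵇ b r) ≡ indicator t
count-guarded-single true r = count-single r
count-guarded-single {n} false r = count-false {n}

count-split : ∀ m {n} (f : Fin (m + n) → Bool) →
  count f ≡ count (λ i → f (i ↑ˡ n)) + count (λ j → f (m ↑ʳ j))
count-split zero f = refl
count-split (suc m) f =
  trans (cong (indicator (f zero) +_) (count-split m (f ∘ suc))) (sym (+-assoc (indicator (f zero)) _ _))

ShorterThan : ∀ {n} → Adjacency n → Fin n → Fin n → ℕ → Set
ShorterThan adj u v D = Σ ℕ λ k → (k < D) × Walk adj u v k

Homomorphism : ∀ {m m'} → Adjacency m → Adjacency m' → (Fin m → Fin m') → Set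
Homomorphism {m} adj adj' f = (a b : Fin m) → adj a b ≡ true → adj' (f a) (f b) ≡ true

module _ {n : ℕ} {adj : Adjacency n} where

  _++ʷ_ : ∀ {u v w k l} → Walk adj u v k → Walk adj v w l → Walk adj u w (k + l)
  here ++ʷ q = q
  step e p ++ʷ q = step e (p ++ʷ q)

  snocʷ : ∀ {u v w k} → Walk adj u v k → adj v w ≡ true → Walk adj u w (suc k)
  snocʷ here e = step e here
  snocʷ (step e' p) e = step e' (snocʷ p e)

  reverseʷ : (∀ a b → adj a b ≡ adj b a) → ∀ {u v k} → Walk adj u v k → Walk adj v u k
  reverseʷ sym-adj here = here
  reverseʷ sym-adj (step {u} {w} e p) = snocʷ (reverseʷ sym-adj p) (trans (sym-adj w u) e)

  dist-trans : ∀ {u v w i j} → DistLe adj u v i → DistLe adj v w j → DistLe adj u w (i + j)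
  dist-trans (k , k≤i , p) (l , l≤j , q) = k + l , +-mono-≤ k≤i l≤j , p ++ʷ q

  dist-mono : ∀ {u v i j} → i ≤ j → DistLe adj u v i → DistLe adj u v j
  dist-mono i≤j (k , k≤i , p) = k , ≤-trans k≤i i≤j , p

  dist-sym : (∀ a b → adj a b ≡ adj b a) → ∀ {u v i} → DistLe adj u v i → DistLe adj v u i
  dist-sym sym-adj (k , k≤i , p) = k , k≤i , reverseʷ sym-adj p

  dist-edge : ∀ {u v} → adj u v ≡ true → DistLe adj u v 1
  dist-edge e = 1 , ≤-refl , step e here

  walk? : ∀ k u v → Dec (Walk adj u v k)
  walk? zero u v with u FinP.≟ v
  ... | yes refl = yes here
  ... | no u≢v = no λ { here → u≢v refl }
  walk? (suc k) u v =
    map′ (λ (w , e , p) → step e p) (λ { (step {w = w} e p) → w , e , p })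
         (FinP.any? λ w → (adj u w ≟ᵇ true) ×-dec walk? k w v)

  shorter? : ∀ u v D → Dec (ShorterThan adj u v D)
  shorter? u v D = anyUpTo? (λ k → walk? k u v) D

dist-map : ∀ {m m'} {adj : Adjacency m} {adj' : Adjacency m'} (f : Fin m → Fin m') →
  Homomorphism adj adj' f → ∀ {u v i} → DistLe adj u v i → DistLe adj' (f u) (f v) i
dist-map {adj = adj} {adj'} f hom (k , k≤i , p) = k , k≤i , mapʷ p
  where
  mapʷ : ∀ {u v k} → Walk adj u v k → Walk adj' (f u) (f v) k
  mapʷ here = here
  mapʷ (step e p) = step (hom _ _ e) (mapʷ p)

short-or-far : ∀ {n} (G : Adjacency n) (D : ℕ) → ((u v : Fin n) → ShorterThan G u v D) ⊎ DiamGe G D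
short-or-far G D with FinP.any? (λ u → FinP.any? (λ v → ¬? (shorter? u v D)))
... | yes (u , v , far) = inj₂ (u , v , λ k k<D w → far (k , k<D , w))
... | no none = inj₁ λ u v → decidable-stable (shorter? u v D) (λ far → none (u , v , far))

module Subdivision {n : ℕ} (G : Adjacency n) (simple : IsSimple G)
                   (x y : Fin n) (xy : G x y ≡ true) where

  S : Adjacency (suc n)
  S = subdivide G x y

  S-sym : ∀ a b → S a b ≡ S b a
  S-sym zero zero = refl
  S-sym zero (suc b) = refl
  S-sym (suc a) zero = refl
  S-sym (suc a) (suc b) rewrite proj₁ simple a b
    | ∧-comm (eqᵇ a x) (eqᵇ b y) | ∧-comm (eqᵇ a y) (eqᵇ b x)
    | ∨-comm (eqᵇ b y ∧ eqᵇ a x) (eqᵇ b x ∧ eqᵇ a y) = refl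

  S-simple : IsSimple S
  S-simple = S-sym , λ { zero → refl ; (suc a) → cong (_∧ _) (proj₂ simple a) }

  yx : G y x ≡ true
  yx = trans (proj₁ simple y x) xy

  S⇒G : ∀ a b → S (suc a) (suc b) ≡ true → G a b ≡ true
  S⇒G a b = ∧-true-left (G a b) _

  xy-removed : S (suc x) (suc y) ≡ false
  xy-removed rewrite eqᵇ-refl x | eqᵇ-refl y = ∧-zeroʳ (G x y)

  yx-removed : S (suc y) (suc x) ≡ false
  yx-removed rewrite eqᵇ-refl x | eqᵇ-refl y
    | ∨-comm (eqᵇ y x ∧ eqᵇ x y) true = ∧-zeroʳ (G y x)

  root-degree : degree S zero ≤ 2
  root-degree = begin
      degree S zero
    ≡⟨ degree≡count S zero ⟩
      count (λ b → eqᵇ b x ∨ eqᵇ b y)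
    ≤⟨ count-∨ (λ b → eqᵇ b x) (λ b → eqᵇ b y) ⟩
      count (λ b → eqᵇ b x) + count (λ b → eqᵇ b y)
    ≡⟨ cong₂ _+_ (count-single x) (count-single y) ⟩
      2
    ∎
    where open ≤-Reasoning

  module _ (subcubic : Subcubic G) where

    G-row : ∀ a → count (G a) ≤ 3
    G-row a = subst (_≤ 3) (degree≡count G a) (subcubic a)

    -- An endpoint a of a removed edge ab keeps at most two old neighbours besides the
    -- new vertex.
    endpoint-degree : ∀ {a} b → G a b ≡ true → S (suc a) (suc b) ≡ false →
      count (S (suc a)) ≤ 3
    endpoint-degree {a} b ab ab-removed = +-mono-≤ (indicator≤1 (S (suc a) zero))
      (≤-pred (≤-trans (count-mono-< b (S⇒G a) ab-removed ab) (G-row a)))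

    -- x and y trade their neighbour y resp. x for the new vertex; every other old vertex
    -- keeps at most its old neighbours.
    S-subcubic : Subcubic S
    S-subcubic zero = ≤-trans root-degree (n≤1+n 2)
    S-subcubic (suc a) =
      subst (_≤ 3) (sym (degree≡count S (suc a))) (old-vertex (a FinP.≟ x) (a FinP.≟ y))
      where
      old-vertex : Dec (a ≡ x) → Dec (a ≡ y) → count (S (suc a)) ≤ 3
      old-vertex (yes refl) _ = endpoint-degree y xy xy-removed
      old-vertex (no _) (yes refl) = endpoint-degree x yx yx-removed
      old-vertex (no a≢x) (no a≢y) rewrite eqᵇ-≢ a≢x | eqᵇ-≢ a≢y =
        ≤-trans (count-mono (λ b → ∧-true-left (G a b) _)) (G-row a)

  -- A walk of G from a to u either meets x or y, and then the new vertex reaches u within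
  -- one more step, or it survives unchanged in S.
  lift : ∀ {a u k} → Walk G a u k → DistLe S zero (suc u) (suc k) ⊎ Walk S (suc a) (suc u) k
  lift here = inj₂ here
  lift (step {a} {w} {u} {k} aw p) with lift p
  ... | inj₁ d = inj₁ (dist-mono (n≤1+n (suc k)) d)
  ... | inj₂ q with eqᵇ w x in wx | eqᵇ w y in wy
  ...   | true | _ = inj₁ (suc k , n≤1+n (suc k) , step (cong (_∨ eqᵇ w y) wx) q)
  ...   | false | true = inj₁ (suc k , n≤1+n (suc k) , step (cong₂ _∨_ wx wy) q)
  ...   | false | false = inj₂ (step kept q)
    where
    kept : S (suc a) (suc w) ≡ true
    kept rewrite wx | wy | ∧-zeroʳ (eqᵇ a x) | ∧-zeroʳ (eqᵇ a y) | aw = refl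

  root-eccentricity : ∀ {D} → (∀ u v → ShorterThan G u v D) → ∀ a → DistLe S zero a D
  root-eccentricity short zero = 0 , z≤n , here
  root-eccentricity short (suc u) with short x u
  ... | k , k<D , p with lift p
  ...   | inj₁ d = dist-mono k<D d
  ...   | inj₂ q = suc k , k<D , step (cong (_∨ eqᵇ x y) (eqᵇ-refl x)) q

doubled-link : ∀ {m} → Adjacency m → Fin m → Fin m ⊎ Fin m → Fin m ⊎ Fin m → Bool
doubled-link K r (inj₁ a) (inj₁ b) = K a b
doubled-link K r (inj₂ a) (inj₂ b) = K a b
doubled-link K r (inj₁ a) (inj₂ b) = eqᵇ a r ∧ eqᵇ b r
doubled-link K r (inj₂ a) (inj₁ b) = eqᵇ a r ∧ eqᵇ b r

doubled : ∀ {m} → Adjacency m → Fin m → Adjacency (m + m)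
doubled {m} K r i j = doubled-link K r (splitAt m i) (splitAt m j)

module Doubled {m : ℕ} (K : Adjacency m) (r : Fin m) where

  H : Adjacency (m + m)
  H = doubled K r

  left right : Fin m → Fin (m + m)
  left a = a ↑ˡ m
  right a = m ↑ʳ a

  copies : ∀ p → (Σ (Fin m) λ a → left a ≡ p) ⊎ (Σ (Fin m) λ a → right a ≡ p)
  copies p with splitAt m p in eq
  ... | inj₁ a = inj₁ (a , FinP.splitAt⁻¹-↑ˡ eq)
  ... | inj₂ a = inj₂ (a , FinP.splitAt⁻¹-↑ʳ eq)

  left≢right : ∀ a b → ¬ left a ≡ right b
  left≢right a b e with trans (sym (FinP.splitAt-↑ˡ m a m)) (trans (cong (splitAt m) e) (FinP.splitAt-↑ʳ m m b))
  ... | ()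

  H-left : ∀ a b → H (left a) (left b) ≡ K a b
  H-left a b rewrite FinP.splitAt-↑ˡ m a m | FinP.splitAt-↑ˡ m b m = refl

  H-right : ∀ a b → H (right a) (right b) ≡ K a b
  H-right a b rewrite FinP.splitAt-↑ʳ m m a | FinP.splitAt-↑ʳ m m b = refl

  H-left-right : ∀ a b → H (left a) (right b) ≡ eqᵇ a r ∧ eqᵇ b r
  H-left-right a b rewrite FinP.splitAt-↑ˡ m a m | FinP.splitAt-↑ʳ m m b = refl

  H-right-left : ∀ a b → H (right a) (left b) ≡ eqᵇ a r ∧ eqᵇ b r
  H-right-left a b rewrite FinP.splitAt-↑ʳ m m a | FinP.splitAt-↑ˡ m b m = refl

  left-hom : Homomorphism K H left
  left-hom a b e = trans (H-left a b) e

  right-hom : Homomorphism K H right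
  right-hom a b e = trans (H-right a b) e

  left-injective : Injective _≡_ _≡_ left
  left-injective = FinP.↑ˡ-injective m _ _

  right-injective : Injective _≡_ _≡_ right
  right-injective = FinP.↑ʳ-injective m _ _

  bridge : H (left r) (right r) ≡ true
  bridge rewrite H-left-right r r | eqᵇ-refl r = refl

  bridge⁻¹ : H (right r) (left r) ≡ true
  bridge⁻¹ rewrite H-right-left r r | eqᵇ-refl r = refl

  doubled-simple : IsSimple K → IsSimple H
  doubled-simple (K-sym , K-irr) =
    (λ p q → link-sym (splitAt m p) (splitAt m q)) , (λ p → link-irr (splitAt m p))
    where
    link-sym : ∀ s t → doubled-link K r s t ≡ doubled-link K r t s
    link-sym (inj₁ a) (inj₁ b) = K-sym a b
    link-sym (inj₂ a) (inj₂ b) = K-sym a b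
    link-sym (inj₁ a) (inj₂ b) = ∧-comm (eqᵇ a r) (eqᵇ b r)
    link-sym (inj₂ a) (inj₁ b) = ∧-comm (eqᵇ a r) (eqᵇ b r)
    link-irr : ∀ s → doubled-link K r s s ≡ false
    link-irr (inj₁ a) = K-irr a
    link-irr (inj₂ a) = K-irr a

  degree-left : ∀ a → degree H (left a) ≡ count (K a) + indicator (eqᵇ a r)
  degree-left a = begin
      degree H (left a)
    ≡⟨ degree≡count H (left a) ⟩
      count (H (left a))
    ≡⟨ count-split m (H (left a)) ⟩
      count (H (left a) ∘ left) + count (H (left a) ∘ right)
    ≡⟨ cong₂ _+_ (count-cong (H-left a)) (count-cong (H-left-right a)) ⟩
      count (K a) + count (λ b → eqᵇ a r ∧ eqᵇ b r)
    ≡⟨ cong (count (K a) +_) (count-guarded-single (eqᵇ a r) r) ⟩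
      count (K a) + indicator (eqᵇ a r)
    ∎
    where open ≡-Reasoning

  degree-right : ∀ a → degree H (right a) ≡ count (K a) + indicator (eqᵇ a r)
  degree-right a = begin
      degree H (right a)
    ≡⟨ degree≡count H (right a) ⟩
      count (H (right a))
    ≡⟨ count-split m (H (right a)) ⟩
      count (H (right a) ∘ left) + count (H (right a) ∘ right)
    ≡⟨ cong₂ _+_ (count-cong (H-right-left a)) (count-cong (H-right a)) ⟩
      count (λ b → eqᵇ a r ∧ eqᵇ b r) + count (K a)
    ≡⟨ cong (_+ count (K a)) (count-guarded-single (eqᵇ a r) r) ⟩
      indicator (eqᵇ a r) + count (K a)
    ≡⟨ +-comm (indicator (eqᵇ a r)) (count (K a)) ⟩
      count (K a) + indicator (eqᵇ a r)
    ∎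
    where open ≡-Reasoning

  module _ (subcubic : Subcubic K) (root-degree : degree K r ≤ 2) where

    row-bound : ∀ a → count (K a) + indicator (eqᵇ a r) ≤ 3
    row-bound a = bound (a FinP.≟ r)
      where
      bound : Dec (a ≡ r) → count (K a) + indicator (eqᵇ a r) ≤ 3
      bound (yes refl) rewrite eqᵇ-refl r =
        +-monoˡ-≤ 1 (subst (_≤ 2) (degree≡count K r) root-degree)
      bound (no a≢r) rewrite eqᵇ-≢ a≢r | +-identityʳ (count (K a)) =
        subst (_≤ 3) (degree≡count K a) (subcubic a)

    doubled-subcubic : Subcubic H
    doubled-subcubic p with copies p
    ... | inj₁ (a , refl) = subst (_≤ 3) (sym (degree-left a)) (row-bound a)
    ... | inj₂ (a , refl) = subst (_≤ 3) (sym (degree-right a)) (row-bound a)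

  doubled-diameter : ∀ {D} → (∀ a b → K a b ≡ K b a) → (∀ a → DistLe K r a D) →
    ∀ p q → DistLe H p q (D + 1 + D)
  doubled-diameter {D} K-sym from-root p q = by-copies (copies p) (copies q)
    where
    to-root : ∀ a → DistLe K a r D
    to-root a = dist-sym K-sym (from-root a)

    D+D≤ : D + D ≤ D + 1 + D
    D+D≤ = +-monoˡ-≤ D (m≤m+n D 1)

    by-copies : (Σ (Fin m) λ a → left a ≡ p) ⊎ (Σ (Fin m) λ a → right a ≡ p) →
                (Σ (Fin m) λ b → left b ≡ q) ⊎ (Σ (Fin m) λ b → right b ≡ q) →
                DistLe H p q (D + 1 + D)
    by-copies (inj₁ (a , refl)) (inj₁ (b , refl)) = dist-mono D+D≤
      (dist-trans (dist-map left left-hom (to-root a)) (dist-map left left-hom (from-root b)))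
    by-copies (inj₂ (a , refl)) (inj₂ (b , refl)) = dist-mono D+D≤
      (dist-trans (dist-map right right-hom (to-root a)) (dist-map right right-hom (from-root b)))
    by-copies (inj₁ (a , refl)) (inj₂ (b , refl)) =
      dist-trans (dist-trans (dist-map left left-hom (to-root a)) (dist-edge bridge))
                 (dist-map right right-hom (from-root b))
    by-copies (inj₂ (a , refl)) (inj₁ (b , refl)) =
      dist-trans (dist-trans (dist-map right right-hom (to-root a)) (dist-edge bridge⁻¹))
                 (dist-map left left-hom (from-root b))

  four : Fin m → Fin m → Fin m → Fin m → Fin 4 → Fin (m + m)
  four a b c d 0F = left a
  four a b c d 1F = left b
  four a b c d 2F = right c
  four a b c d 3F = right d

  four-injective : ∀ {a b c d} → ¬ a ≡ b → ¬ c ≡ d → Injective _≡_ _≡_ (four a b c d)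
  four-injective a≢b c≢d {0F} {0F} _ = refl
  four-injective a≢b c≢d {1F} {1F} _ = refl
  four-injective a≢b c≢d {2F} {2F} _ = refl
  four-injective a≢b c≢d {3F} {3F} _ = refl
  four-injective a≢b c≢d {0F} {1F} e = ⊥-elim (a≢b (left-injective e))
  four-injective a≢b c≢d {1F} {0F} e = ⊥-elim (a≢b (sym (left-injective e)))
  four-injective a≢b c≢d {2F} {3F} e = ⊥-elim (c≢d (right-injective e))
  four-injective a≢b c≢d {3F} {2F} e = ⊥-elim (c≢d (sym (right-injective e)))
  four-injective a≢b c≢d {0F} {2F} e = ⊥-elim (left≢right _ _ e)
  four-injective a≢b c≢d {0F} {3F} e = ⊥-elim (left≢right _ _ e)
  four-injective a≢b c≢d {1F} {2F} e = ⊥-elim (left≢right _ _ e)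
  four-injective a≢b c≢d {1F} {3F} e = ⊥-elim (left≢right _ _ e)
  four-injective a≢b c≢d {2F} {0F} e = ⊥-elim (left≢right _ _ (sym e))
  four-injective a≢b c≢d {2F} {1F} e = ⊥-elim (left≢right _ _ (sym e))
  four-injective a≢b c≢d {3F} {0F} e = ⊥-elim (left≢right _ _ (sym e))
  four-injective a≢b c≢d {3F} {1F} e = ⊥-elim (left≢right _ _ (sym e))

restrict : ∀ {m m' k} {adj : Adjacency m} {adj' : Adjacency m'} {c : Fin m' → ℕ}
  (f : Fin m → Fin m') → Injective _≡_ _≡_ f → Homomorphism adj adj' f →
  IsPackingColoring adj' k c → IsPackingColoring adj k (c ∘ f)
restrict f f-inj hom (bounds , packed) =
  bounds ∘ f , λ u v u≢v same d → packed (f u) (f v) (u≢v ∘ f-inj) same (dist-map f hom d)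

weaken : ∀ {m k k'} {adj : Adjacency m} {c : Fin m → ℕ} → k ≤ k' →
  IsPackingColoring adj k c → IsPackingColoring adj k' c
weaken k≤k' (bounds , packed) = (λ v → proj₁ (bounds v) , ≤-trans (proj₂ (bounds v)) k≤k') , packed

AtMostOneLarge : ∀ {m} → ℕ → (Fin m → ℕ) → Set
AtMostOneLarge {m} L c = (u v : Fin m) → L ≤ c u → L ≤ c v → u ≡ v

TwoLarge : ∀ {m} → ℕ → (Fin m → ℕ) → Set
TwoLarge {m} L c = Σ (Fin m) λ u → Σ (Fin m) λ v → (L ≤ c u) × (L ≤ c v) × ¬ u ≡ v

large-dichotomy : ∀ {m} L (c : Fin m → ℕ) → AtMostOneLarge L c ⊎ TwoLarge L c
large-dichotomy L c
  with FinP.any? (λ u → FinP.any? λ v → (L ≤? c u) ×-dec (L ≤? c v) ×-dec ¬? (u FinP.≟ v))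
... | yes (u , v , Lu , Lv , u≢v) = inj₂ (u , v , Lu , Lv , u≢v)
... | no none = inj₁ λ u v Lu Lv → decidable-stable (u FinP.≟ v) λ u≢v → none (u , v , Lu , Lv , u≢v)

truncate : ∀ {m k L} {adj : Adjacency m} {c : Fin m → ℕ} → 1 ≤ L → AtMostOneLarge L c →
  IsPackingColoring adj k c → IsPackingColoring adj L (λ v → c v ⊓ L)
truncate {L = L} {adj} {c} 1≤L sparse (bounds , packed) =
  (λ v → ⊓-glb (proj₁ (bounds v)) 1≤L , m⊓n≤n (c v) L) , packed-truncated
  where
  packed-truncated : ∀ u v → ¬ u ≡ v → c u ⊓ L ≡ c v ⊓ L → ¬ DistLe adj u v (c u ⊓ L)
  packed-truncated u v u≢v same d with L ≤? c u | L ≤? c v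
  ... | yes Lu | yes Lv = u≢v (sparse u v Lu Lv)
  ... | yes Lu | no v-small =
        <⇒≢ (≰⇒> v-small) (sym (trans (sym (m≥n⇒m⊓n≡n Lu)) (trans same (m≤n⇒m⊓n≡m (<⇒≤ (≰⇒> v-small))))))
  ... | no u-small | yes Lv =
        <⇒≢ (≰⇒> u-small) (trans (sym (m≤n⇒m⊓n≡m (<⇒≤ (≰⇒> u-small)))) (trans same (m≥n⇒m⊓n≡n Lv)))
  ... | no u-small | no v-small =
        packed u v u≢v
          (trans (sym (m≤n⇒m⊓n≡m (<⇒≤ (≰⇒> u-small)))) (trans same (m≤n⇒m⊓n≡m (<⇒≤ (≰⇒> v-small)))))
          (dist-mono (m⊓n≤m (c u) L) d)

-- In a graph of diameter ≤ L each colour ≥ L of a packing colouring is used at most once;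
-- with colours ≤ k + L there are k + 1 of them, so no k + 2 distinct vertices all get
-- colours ≥ L (pigeonhole).
few-large : ∀ {m k L} {adj : Adjacency m} {c : Fin m → ℕ} →
  IsPackingColoring adj (k + L) c → (∀ p q → DistLe adj p q L) →
  (f : Fin (suc (suc k)) → Fin m) → Injective _≡_ _≡_ f → ¬ (∀ i → L ≤ c (f i))
few-large {m} {k} {L} {adj} {c} (bounds , packed) close f f-inj large =
  let (i , j , i<j , same-offset) = FinP.pigeonhole (n<1+n (suc k)) offset
  in collision (FinP.<⇒≢ i<j ∘ f-inj) same-offset
  where
  offset-bound : ∀ i → c (f i) ∸ L < suc k
  offset-bound i = s≤s (subst (c (f i) ∸ L ≤_) (m+n∸n≡m k L) (∸-monoˡ-≤ L (proj₂ (bounds (f i)))))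

  offset : Fin (suc (suc k)) → Fin (suc k)
  offset i = fromℕ< (offset-bound i)

  collision : ∀ {i j} → ¬ f i ≡ f j → offset i ≡ offset j → ⊥
  collision {i} {j} fi≢fj same-offset =
    packed (f i) (f j) fi≢fj same-colour (dist-mono (large i) (close (f i) (f j)))
    where
    same-colour : c (f i) ≡ c (f j)
    same-colour = begin
        c (f i)
      ≡⟨ sym (m∸n+n≡m (large i)) ⟩
        c (f i) ∸ L + L
      ≡⟨ cong (_+ L) (trans (sym (FinP.toℕ-fromℕ< (offset-bound i)))
                     (trans (cong toℕ same-offset) (FinP.toℕ-fromℕ< (offset-bound j)))) ⟩
        c (f j) ∸ L + L
      ≡⟨ m∸n+n≡m (large j) ⟩
        c (f j)
      ∎
      where open ≡-Reasoning

-- In a doubled graph of diameter ≤ L coloured with L + 2 colours, one of the two copies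
-- carries at most one vertex of colour ≥ L: otherwise four distinct vertices would share
-- the three colours L, L + 1, L + 2.
one-copy-sparse : ∀ {m L} (K : Adjacency m) (r : Fin m) {c : Fin (m + m) → ℕ} →
  let open Doubled K r in
  (∀ p q → DistLe H p q L) → IsPackingColoring H (2 + L) c →
  AtMostOneLarge L (c ∘ left) ⊎ AtMostOneLarge L (c ∘ right)
one-copy-sparse {L = L} K r {c} close colouring with large-dichotomy L (c ∘ Doubled.left K r)
... | inj₁ sparse = inj₁ sparse
... | inj₂ (a , b , La , Lb , a≢b) = inj₂ λ u v Lu Lv →
      decidable-stable (u FinP.≟ v) λ u≢v →
        few-large colouring close (four a b u v) (four-injective a≢b u≢v) λ
          { 0F → La ; 1F → Lb ; 2F → Lu ; 3F → Lv }
  where open Doubled K r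

subdivision-colouring : ∀ {n} M D → D + 1 + D ≤ M ∸ 2 →
  ((m : ℕ) (H : Adjacency m) → IsSimple H → Subcubic H → PackChromLe H M) →
  (G : Adjacency n) → IsSimple G → Subcubic G → (∀ u v → ShorterThan G u v D) →
  (x y : Fin n) → G x y ≡ true → PackChromLe (subdivide G x y) (M ∸ 2)
subdivision-colouring {n} M D 2D+1≤L colourable G simple subcubic short x y xy =
  colour-sparse-copy (one-copy-sparse S zero close colouring)
  where
  open Subdivision G simple x y xy
  open Doubled S zero

  L : ℕ
  L = M ∸ 2

  coloured-H : PackChromLe H M
  coloured-H = colourable (suc n + suc n) H (doubled-simple S-simple)
    (doubled-subcubic (S-subcubic subcubic) root-degree)

  c : Fin (suc n + suc n) → ℕ
  c = proj₁ coloured-H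

  colouring : IsPackingColoring H (2 + L) c
  colouring = weaken (m≤n+m∸n M 2) (proj₂ coloured-H)

  close : ∀ p q → DistLe H p q L
  close p q = dist-mono 2D+1≤L (doubled-diameter S-sym (root-eccentricity short) p q)

  1≤L : 1 ≤ L
  1≤L = ≤-trans (≤-trans (m≤n+m 1 D) (m≤m+n (D + 1) D)) 2D+1≤L

  colour-sparse-copy : AtMostOneLarge L (c ∘ left) ⊎ AtMostOneLarge L (c ∘ right) →
    PackChromLe S L
  colour-sparse-copy (inj₁ sparse) =
    _ , truncate 1≤L sparse (restrict left left-injective left-hom colouring)
  colour-sparse-copy (inj₂ sparse) =
    _ , truncate 1≤L sparse (restrict right right-injective right-hom colouring)

-- If d = ⌈M/2⌉ - 2 ≥ 1 then M ≥ 2d + 3, so d + 1 + d ≤ M - 2.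
ceilHalf-room : ∀ M → 1 ≤ ceilHalf M ∸ 2 → (ceilHalf M ∸ 2) + 1 + (ceilHalf M ∸ 2) ≤ M ∸ 2
ceilHalf-room M 1≤d with ceilHalf M | m/n*n≤m (suc M) 2
... | suc (suc (suc d)) | twice-half≤ =
      m+n≤o⇒m≤o∸n (suc d + 1 + suc d) (≤-pred (subst (_≤ suc M) (doubling d) twice-half≤))
  where
  doubling : ∀ d → (3 + d) * 2 ≡ suc (suc d + 1 + suc d + 2)
  doubling = solve-∀

theorem2p1 : (M : ℕ) →
    ((m : ℕ) (H : Adjacency m) → IsSimple H → Subcubic H → PackChromLe H M) →
    (n : ℕ) (G : Adjacency n) → IsSimple G → Subcubic G → PackChromEq G M →
    ((x y : Fin n) → G x y ≡ true → PackChromLe (subdivide G x y) (M ∸ 2))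
      ⊎ DiamGe G (ceilHalf M ∸ 2)
theorem2p1 M colourable n G simple subcubic _ with short-or-far G (ceilHalf M ∸ 2)
... | inj₂ far = inj₂ far
... | inj₁ short = inj₁ λ x y xy →
  let -- the walk from x to itself shows that ⌈M/2⌉ - 2 ≥ 1
      (k , k<D , _) = short x x
  in subdivision-colouring M (ceilHalf M ∸ 2) (ceilHalf-room M (≤-trans (s≤s z≤n) k<D))
       colourable G simple subcubic short x y xy
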